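{- For every ranked set with multiplicities $M=(M,\operatorname{rk},m)$ (with multiplicities in a commutative ring $R$ with $1$), \[ \mathfrak{M}_M(x+1,y+1)=(\xi(1,y)\circ\zeta(x,1))(M)=(\zeta(1,y)\circ\xi^*(x,1))(M), \] where for a ranked set with multiplicities $N$: $\xi(1,y)(N)=m_N(N)\,y^{|N|-\operatorname{rk}(N)}$, $\xi^*(x,1)(N)=m_N(\emptyset)\,x^{\operatorname{rk}(N)}$, $\zeta(x,1)(N)=x^{\operatorname{rk}(N)}$, $\zeta(1,y)(N)=y^{|N|-\operatorname{rk}(N)}$.
   Context: A ranked set with multiplicities is a triple $(M,\operatorname{rk},m)$ with $M$ a finite set, $\operatorname{rk}:2^M\to\mathbb{Z}$ satisfying $\operatorname{rk}(\emptyset)=0$, and $m:2^M\to R$ arbitrary; $m_N$ denotes the multiplicity function of $N$ and $m_N(N)$ its value on the whole ground set. Restriction: $M|_A=(A,\operatorname{rk}|_{2^A},m|_{2^A})$. Contraction: $M/A=(M\setminus A,\operatorname{rk}_{M/A},m_{M/A})$ with $\operatorname{rk}_{M/A}(B)=\operatorname{rk}(B\cup A)-\operatorname{rk}(A)$, $m_{M/A}(B)=m(B\cup A)$. Convolution: $(f\circ g)(M)=\sum_{A\subseteq M}f(M|_A)g(M/A)$. The arithmetic Tutte function is $\mathfrak{M}_M(x,y)=\sum_{A\subseteq M}m(A)(x-1)^{\operatorname{rk}(M)-\operatorname{rk}(A)}(y-1)^{|A|-\operatorname{rk}(A)}$. -}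

module Defs where

open import Level using (Level)
open import Data.Nat using (ℕ; zero; suc)
open import Data.Integer using (ℤ; +_; -[1+_]) renaming (_-_ to _-ℤ_)
open import Data.Vec using (_∷_; [])
open import Data.List using (List; []; _∷_; map; _++_; foldr)
open import Data.Fin.Subset using (Subset; Side; inside; outside; ⊥; _∪_; _─_; ∣_∣)
open import Algebra.Bundles using (CommutativeRing)

-- The finite ground set M is represented as a subset `ground` of an
-- ambient finite set Fin n; rk and m are given on all subsets of Fin n,
-- but only their values on subsets of `ground` are meaningful (every
-- notion below only evaluates them there).
record RankedSet {a : Level} (A : Set a) : Set a where
  field
    n      : ℕ
    ground : Subset n
    rk     : Subset n → ℤ
    mult   : Subset n → A
open RankedSet public

restrict : ∀ {a} {A : Set a} → (M : RankedSet A) → Subset (n M) → RankedSet A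
restrict M B = record { n = n M ; ground = B ; rk = rk M ; mult = mult M }

contract : ∀ {a} {A : Set a} → (M : RankedSet A) → Subset (n M) → RankedSet A
contract M B = record
  { n = n M
  ; ground = ground M ─ B
  ; rk = λ C → rk M (C ∪ B) -ℤ rk M B
  ; mult = λ C → mult M (C ∪ B)
  }

subsetsOf : ∀ {k} → Subset k → List (Subset k)
subsetsOf [] = [] ∷ []
subsetsOf (inside ∷ G)  = map (inside ∷_) (subsetsOf G) ++ map (outside ∷_) (subsetsOf G)
subsetsOf (outside ∷ G) = map (outside ∷_) (subsetsOf G)

module _ {c ℓ : Level} (R : CommutativeRing c ℓ) where
  open CommutativeRing R

  sumR : List Carrier → Carrier
  sumR = foldr _+_ 0#

  powℕ : Carrier → ℕ → Carrier
  powℕ x zero = 1#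
  powℕ x (suc k) = x * powℕ x k

  powℤ : (a a⁻¹ : Carrier) → ℤ → Carrier
  powℤ a a⁻¹ (+ k) = powℕ a k
  powℤ a a⁻¹ -[1+ k ] = powℕ a⁻¹ (suc k)

  nullity : (M : RankedSet Carrier) → Subset (n M) → ℤ
  nullity M B = + ∣ B ∣ -ℤ rk M B

  conv : (RankedSet Carrier → Carrier) → (RankedSet Carrier → Carrier) → RankedSet Carrier → Carrier
  conv f g M = sumR (map (λ B → f (restrict M B) * g (contract M B)) (subsetsOf (ground M)))

  -- Arithmetic Tutte function  𝔐_M(X,Y) = Σ_{B ⊆ M} m(B) (X-1)^{rk M - rk B} (Y-1)^{|B| - rk B}.
  -- Xi, Yi are inverses of X - 1 and Y - 1 (used for negative exponents).
  arithTutte : RankedSet Carrier → (X Xi Y Yi : Carrier) → Carrier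
  arithTutte M X Xi Y Yi =
    sumR (map (λ B → mult M B * powℤ (X - 1#) Xi (rk M (ground M) -ℤ rk M B)
                               * powℤ (Y - 1#) Yi (nullity M B))
              (subsetsOf (ground M)))

  ξ1y : (y y⁻¹ : Carrier) → RankedSet Carrier → Carrier
  ξ1y y y⁻¹ N = mult N (ground N) * powℤ y y⁻¹ (nullity N (ground N))

  ξ*x1 : (x x⁻¹ : Carrier) → RankedSet Carrier → Carrier
  ξ*x1 x x⁻¹ N = mult N ⊥ * powℤ x x⁻¹ (rk N (ground N))

  ζx1 : (x x⁻¹ : Carrier) → RankedSet Carrier → Carrier
  ζx1 x x⁻¹ N = powℤ x x⁻¹ (rk N (ground N))

  ζ1y : (y y⁻¹ : Carrier) → RankedSet Carrier → Carrier
  ζ1y y y⁻¹ N = powℤ y y⁻¹ (nullity N (ground N))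

-- Both convolutions and the arithmetic Tutte function are sums over the
-- same list  subsetsOf (ground M)  of subsets B ⊆ M, so both identities
-- are proved term by term.  The only structural input is that for every
-- such B the contraction M/B has ground set M ∖ B with (M ∖ B) ∪ B = M;
-- hence rk(M/B) = rk M - rk B and m_{M/B}(∅) = m(B).  With this:
--   * the B-term of 𝔐_M(x+1, y+1) is  m(B) x^{rk M - rk B} y^{|B| - rk B},
--     which is ξ(1,y)(M|_B) · ζ(x,1)(M/B) after commuting two factors;
--   * ξ(1,y)(M|_B) · ζ(x,1)(M/B) = m(B) y^{|B|-rk B} x^{rk M - rk B}
--     = ζ(1,y)(M|_B) · ξ*(x,1)(M/B) after moving y^{|B|-rk B} to the front.
module Submission where

open import Defs
open import Level using (Level)
open import Data.Product using (_×_; _,_)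
open import Algebra.Bundles using (CommutativeRing)
open import Data.Nat using (zero; suc)
open import Data.Integer using (+_; -[1+_]) renaming (_-_ to _-ℤ_)
open import Data.Vec using (_∷_; [])
open import Data.List using (List; []; _∷_; map)
open import Data.List.Relation.Unary.All as All using (All; []; _∷_)
open import Data.List.Relation.Unary.All.Properties using (++⁺; map⁺)
open import Data.Fin.Subset using (Subset; inside; outside; ⊥; _∪_; _─_)
open import Data.Fin.Subset.Properties using (∪-identityˡ)
open import Relation.Binary.PropositionalEquality using (_≡_; refl; cong)
import Algebra.Properties.Group as GroupProperties
import Algebra.Properties.CommutativeSemigroup as CommutativeSemigroupProperties

subsetsOf-reassemble : ∀ {k} (G : Subset k) → All (λ B → (G ─ B) ∪ B ≡ G) (subsetsOf G)
subsetsOf-reassemble [] = refl ∷ []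
subsetsOf-reassemble (inside ∷ G) =
  ++⁺ (map⁺ (All.map (cong (inside ∷_)) (subsetsOf-reassemble G)))
      (map⁺ (All.map (cong (inside ∷_)) (subsetsOf-reassemble G)))
subsetsOf-reassemble (outside ∷ G) =
  map⁺ (All.map (cong (outside ∷_)) (subsetsOf-reassemble G))

module _ {a : Level} {A : Set a} (M : RankedSet A) (B : Subset (n M)) where

  contract-rank : (ground M ─ B) ∪ B ≡ ground M →
    rk (contract M B) (ground (contract M B)) ≡ rk M (ground M) -ℤ rk M B
  contract-rank reassembled = cong (λ S → rk M S -ℤ rk M B) reassembled

  contract-mult-∅ : mult (contract M B) ⊥ ≡ mult M B
  contract-mult-∅ = cong (mult M) (∪-identityˡ B)

module _ {c ℓ : Level} (R : CommutativeRing c ℓ) where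
  open CommutativeRing R renaming (refl to ≈-refl)
  open import Relation.Binary.Reasoning.Setoid setoid
  open GroupProperties +-group using (//-rightDividesʳ)
  open CommutativeSemigroupProperties *-commutativeSemigroup using (xy∙z≈xz∙y; xy∙z≈y∙xz)

  sumR-cong : ∀ {b p} {I : Set b} {P : I → Set p} (f g : I → Carrier) (L : List I) →
    All P L → (∀ i → P i → f i ≈ g i) → sumR R (map f L) ≈ sumR R (map g L)
  sumR-cong f g [] [] f≈g = ≈-refl
  sumR-cong f g (i ∷ L) (Pi ∷ PL) f≈g = +-cong (f≈g i Pi) (sumR-cong f g L PL f≈g)

  powℕ-cong : ∀ {u v} k → u ≈ v → powℕ R u k ≈ powℕ R v k
  powℕ-cong zero    u≈v = ≈-refl
  powℕ-cong (suc k) u≈v = *-cong u≈v (powℕ-cong k u≈v)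

  powℤ-cong : ∀ {u v} u⁻¹ e → u ≈ v → powℤ R u u⁻¹ e ≈ powℤ R v u⁻¹ e
  powℤ-cong u⁻¹ (+ k)    u≈v = powℕ-cong k u≈v
  powℤ-cong u⁻¹ -[1+ k ] u≈v = ≈-refl

  shift-back : ∀ x → (x + 1#) - 1# ≈ x
  shift-back x = //-rightDividesʳ 1# x

  module _ (M : RankedSet Carrier) (x x⁻¹ y y⁻¹ : Carrier) where
    private
      G = ground M

    tutte-term : ∀ B → (G ─ B) ∪ B ≡ G →
      mult M B * powℤ R ((x + 1#) - 1#) x⁻¹ (rk M G -ℤ rk M B)
               * powℤ R ((y + 1#) - 1#) y⁻¹ (nullity R M B)
      ≈ ξ1y R y y⁻¹ (restrict M B) * ζx1 R x x⁻¹ (contract M B)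
    tutte-term B reassembled = begin
      mult M B * powℤ R ((x + 1#) - 1#) x⁻¹ (rk M G -ℤ rk M B)
               * powℤ R ((y + 1#) - 1#) y⁻¹ (nullity R M B)
        ≈⟨ *-cong (*-congˡ (powℤ-cong x⁻¹ (rk M G -ℤ rk M B) (shift-back x)))
                  (powℤ-cong y⁻¹ (nullity R M B) (shift-back y)) ⟩
      mult M B * powℤ R x x⁻¹ (rk M G -ℤ rk M B) * powℤ R y y⁻¹ (nullity R M B)
        ≈⟨ xy∙z≈xz∙y _ _ _ ⟩
      mult M B * powℤ R y y⁻¹ (nullity R M B) * powℤ R x x⁻¹ (rk M G -ℤ rk M B)
        ≡⟨ cong (λ e → ξ1y R y y⁻¹ (restrict M B) * powℤ R x x⁻¹ e)
                (contract-rank M B reassembled) ⟨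
      ξ1y R y y⁻¹ (restrict M B) * ζx1 R x x⁻¹ (contract M B) ∎

    convolution-term : ∀ B →
      ξ1y R y y⁻¹ (restrict M B) * ζx1 R x x⁻¹ (contract M B)
      ≈ ζ1y R y y⁻¹ (restrict M B) * ξ*x1 R x x⁻¹ (contract M B)
    convolution-term B = begin
      mult M B * ζ1y R y y⁻¹ (restrict M B) * ζx1 R x x⁻¹ (contract M B)
        ≈⟨ xy∙z≈y∙xz _ _ _ ⟩
      ζ1y R y y⁻¹ (restrict M B) * (mult M B * ζx1 R x x⁻¹ (contract M B))
        ≡⟨ cong (λ m → ζ1y R y y⁻¹ (restrict M B) * (m * ζx1 R x x⁻¹ (contract M B)))
                (contract-mult-∅ M B) ⟨
      ζ1y R y y⁻¹ (restrict M B) * ξ*x1 R x x⁻¹ (contract M B) ∎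

lemma3p4 : {c ℓ : Level} (R : CommutativeRing c ℓ) →
    let open CommutativeRing R in
    (M : RankedSet Carrier) (x x⁻¹ y y⁻¹ : Carrier) →
    x * x⁻¹ ≈ 1# → y * y⁻¹ ≈ 1# →
    (arithTutte R M (x + 1#) x⁻¹ (y + 1#) y⁻¹ ≈ conv R (ξ1y R y y⁻¹) (ζx1 R x x⁻¹) M)
    × (conv R (ξ1y R y y⁻¹) (ζx1 R x x⁻¹) M ≈ conv R (ζ1y R y y⁻¹) (ξ*x1 R x x⁻¹) M)
lemma3p4 R M x x⁻¹ y y⁻¹ _ _ =
    sumR-cong R _ _ subsets (subsetsOf-reassemble (ground M)) (tutte-term R M x x⁻¹ y y⁻¹)
  , sumR-cong R _ _ subsets (subsetsOf-reassemble (ground M))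
      (λ B _ → convolution-term R M x x⁻¹ y y⁻¹ B)
  where
    subsets : List (Subset (n M))
    subsets = subsetsOf (ground M)
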